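{- Let $a,b$ be integers with $1\leq a\leq b$, let $h\geq0$ be an integer, and let $Q_{a,b}^{(h)}=U^{a+h}D^aU^bD^{b+h}$. For every integer $r$ with $2\leq r\leq a+b+h$, the number of elements of the interval $[UD,Q_{a,b}^{(h)}]$ of the Dyck pattern poset having semilength $r$ is $$s_0^{(r)}[UD,Q_{a,b}^{(h)}]=\sum_{i=\max\{1,r-b-h\}}^{\min\{a,r-1\}}\bigl(\min\{b,r-i\}-\max\{1,r-a-h\}+1\bigr)+[r\leq b+h],$$ where $[\Omega]$ equals $1$ if the statement $\Omega$ is true and $0$ otherwise.
   Context: A Dyck path is a word over $\{U,D\}$ with equally many $U$'s and $D$'s such that every prefix has at least as many $U$'s as $D$'s; its semilength is its number of $U$'s. The Dyck pattern poset is the set of nonempty Dyck paths ordered by $P\leq Q$ iff $P$ is a subword of $Q$ (obtained by deleting letters, not necessarily consecutive). $U^a$ denotes $a$ consecutive $U$'s. The paper assumes throughout this section that $b\geq a\geq1$. -}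

module Defs where

open import Data.Nat using (ℕ; zero; suc; _+_; _∸_; _⊔_; _⊓_; _≤ᵇ_)
open import Data.Bool using (if_then_else_)
open import Data.List using (List; []; _∷_; _++_; replicate; map; upTo; length)
open import Data.Nat.ListAction using (sum)
open import Data.List.Relation.Binary.Sublist.Propositional using (_⊆_)

data Step : Set where
  U D : Step

Word : Set
Word = List Step

-- DyckFrom n w : starting at height n, reading w never goes below 0
-- and ends at height 0.  Dyck w = DyckFrom 0 w (every prefix has at
-- least as many U's as D's, and equally many in total).
data DyckFrom : ℕ → Word → Set where
  done : DyckFrom zero []
  up   : ∀ {n w} → DyckFrom (suc n) w → DyckFrom n (U ∷ w)
  down : ∀ {n w} → DyckFrom n w → DyckFrom (suc n) (D ∷ w)

Dyck : Word → Set
Dyck = DyckFrom zero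

semilength : Word → ℕ
semilength [] = zero
semilength (U ∷ w) = suc (semilength w)
semilength (D ∷ w) = semilength w

-- order of the Dyck pattern poset: P ≤ Q iff P is a (scattered) subword of Q
_≼_ : Word → Word → Set
P ≼ Q = P ⊆ Q

UD : Word
UD = U ∷ D ∷ []

Qabh : ℕ → ℕ → ℕ → Word
Qabh a b h = replicate (a + h) U ++ replicate a D ++ replicate b U ++ replicate (b + h) D

-- P lies in the interval [UD, Q] of the Dyck pattern poset and has semilength r
-- (nonempty Dyck paths; UD ≼ P already forces nonemptiness)
InIntervalOfSemilength : Word → ℕ → Word → Set
InIntervalOfSemilength Q r P = Dyck P × (UD ≼ P × (P ≼ Q × semilength P ≡ r))
  where
  open import Data.Product using (_×_)
  open import Relation.Binary.PropositionalEquality using (_≡_)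

-- Σ_{i=lo}^{hi} f i  (empty sum, = 0, when hi < lo)
sumFromTo : ℕ → ℕ → (ℕ → ℕ) → ℕ
sumFromTo lo hi f = sum (map (λ k → f (lo + k)) (upTo (suc hi ∸ lo)))

iver≤ : ℕ → ℕ → ℕ
iver≤ r m = if r ≤ᵇ m then 1 else 0

-- the right-hand side of the formula; each summand
-- min{b,r-i} - max{1,r-a-h} + 1 is ≥ 1 in the summation range when
-- 2 ≤ r ≤ a+b+h, so truncated subtraction on ℕ is exact here.
formula : ℕ → ℕ → ℕ → ℕ → ℕ
formula a b h r =
  sumFromTo (1 ⊔ (r ∸ (b + h))) (a ⊓ (r ∸ 1))
    (λ i → ((b ⊓ (r ∸ i)) + 1) ∸ (1 ⊔ (r ∸ (a + h))))
  + iver≤ r (b + h)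

-- A subword of Q = U^(a+h) D^a U^b D^(b+h) has the shape U^x D^y U^z D^w with every run
-- bounded by the corresponding run of Q, and it is a Dyck path exactly when x - y = w - z ≥ 0.
-- Of semilength r, such a path either has one peak, U^r D^r, which lies below Q iff r ≤ b + h,
-- or has two peaks and is determined by its first descent i and second ascent z; the run
-- bounds then say precisely that (i , z) ranges over the double sum of the formula.
module Submission where

open import Defs
open import Algebra.Properties.CommutativeSemigroup as CommSemigroup using ()
open import Data.Bool using (Bool; true; false; if_then_else_; T)
open import Data.Empty using (⊥-elim)
open import Data.List using (List; []; _∷_; _++_; length; replicate; map; upTo)
open import Data.List.Properties
  using (∷-injective; ++-assoc; ++-identityʳ; length-++; length-map; length-upTo; length-replicate; map-∘; map-cong)
open import Data.List.Membership.Propositional using (_∈_)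
open import Data.List.Membership.Propositional.Properties
  using (∈-map⁺; ∈-map⁻; ∈-++⁺ˡ; ∈-++⁺ʳ; ∈-++⁻; ∈-upTo⁺; ∈-upTo⁻)
open import Data.List.Relation.Unary.Any using (here; there)
open import Data.List.Relation.Unary.All as All using ([])
import Data.List.Relation.Unary.All.Properties as All
open import Data.List.Relation.Unary.AllPairs using ([]; _∷_)
open import Data.List.Relation.Unary.Unique.Propositional using (Unique)
import Data.List.Relation.Unary.Unique.Propositional.Properties as Unique
open import Data.List.Relation.Binary.Sublist.Propositional using (_⊆_; []; _∷_; _∷ʳ_)
open import Data.List.Relation.Binary.Sublist.Propositional.Properties using (++⁺; ++⁺ˡ; []⊆-universal)
open import Data.Nat using (ℕ; zero; suc; _+_; _∸_; _⊔_; _⊓_; _≤_; _<_; _≤ᵇ_; z≤n; s≤s)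
open import Data.Nat.Properties
open import Data.Nat.ListAction using (sum)
open import Data.Product using (Σ; ∃-syntax; _×_; _,_; proj₁; proj₂; uncurry)
open import Data.Sum using (_⊎_; inj₁; inj₂)
open import Function using (_∘_)
open import Function.Bundles using (_⇔_; mk⇔; Equivalence)
open import Relation.Binary.PropositionalEquality
  using (_≡_; _≢_; refl; sym; trans; cong; cong₂; subst; module ≡-Reasoning)
open import Relation.Nullary using (¬_)

open Equivalence using (to; from)
open CommSemigroup +-commutativeSemigroup using (xy∙z≈xz∙y; xy∙z≈zy∙x)

private
  variable
    A B : Set
    c c′ : A
    k m n : ℕ
    l l′ xs : List A

replicate-+ : ∀ m n (c : A) → replicate (m + n) c ≡ replicate m c ++ replicate n c
replicate-+ zero    n c = refl
replicate-+ (suc m) n c = cong (c ∷_) (replicate-+ m n c)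

replicate-++-∷-injective : c ≢ c′ →
  replicate m c ++ c′ ∷ l ≡ replicate n c ++ c′ ∷ l′ → m ≡ n × l ≡ l′
replicate-++-∷-injective {m = zero}  {n = zero}  _    eq = refl , proj₂ (∷-injective eq)
replicate-++-∷-injective {m = zero}  {n = suc _} c≢c′ eq = ⊥-elim (c≢c′ (sym (proj₁ (∷-injective eq))))
replicate-++-∷-injective {m = suc _} {n = zero}  c≢c′ eq = ⊥-elim (c≢c′ (proj₁ (∷-injective eq)))
replicate-++-∷-injective {m = suc _} {n = suc _} c≢c′ eq
  with refl , eq′ ← replicate-++-∷-injective c≢c′ (proj₂ (∷-injective eq)) = refl , eq′

m<n∸o⇒o+m<n : ∀ o → m < n ∸ o → o + m < n
m<n∸o⇒o+m<n                zero    m<n   = m<n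
m<n∸o⇒o+m<n {n = suc n} (suc o) m<n∸o = s≤s (m<n∸o⇒o+m<n o m<n∸o)

range : ℕ → ℕ → List ℕ
range m n = map (m +_) (upTo (n ∸ m))

∈-range⁺ : m ≤ k → k < n → k ∈ range m n
∈-range⁺ {m} {k} {n} m≤k k<n =
  subst (_∈ range m n) (m+[n∸m]≡n m≤k) (∈-map⁺ (m +_) (∈-upTo⁺ (∸-monoˡ-< k<n m≤k)))

∈-range⁻ : k ∈ range m n → m ≤ k × k < n
∈-range⁻ {m = m} k∈ with j , j∈ , refl ← ∈-map⁻ (m +_) k∈ = m≤m+n m j , m<n∸o⇒o+m<n m (∈-upTo⁻ j∈)

length-range : ∀ m n → length (range m n) ≡ n ∸ m
length-range m n = trans (length-map (m +_) (upTo (n ∸ m))) (length-upTo (n ∸ m))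

range-unique : ∀ m n → Unique (range m n)
range-unique m n = Unique.map⁺ (+-cancelˡ-≡ m _ _) (Unique.upTo⁺ (n ∸ m))

sumFromTo-range : ∀ m n f → sumFromTo m n f ≡ sum (map f (range m (suc n)))
sumFromTo-range m n f = cong sum (map-∘ (upTo (suc n ∸ m)))

dependentProduct : List A → (A → List B) → List (A × B)
dependentProduct []       _  = []
dependentProduct (x ∷ xs) ys = map (x ,_) (ys x) ++ dependentProduct xs ys

module _ {ys : A → List B} where

  ∈-dependentProduct⁺ : ∀ {x y} → x ∈ xs → y ∈ ys x → (x , y) ∈ dependentProduct xs ys
  ∈-dependentProduct⁺ {x = x} (here refl) y∈ = ∈-++⁺ˡ (∈-map⁺ (x ,_) y∈)
  ∈-dependentProduct⁺ {xs = x′ ∷ _} (there x∈) y∈ =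
    ∈-++⁺ʳ (map (x′ ,_) (ys x′)) (∈-dependentProduct⁺ x∈ y∈)

  ∈-dependentProduct⁻ : ∀ {x y} → (x , y) ∈ dependentProduct xs ys → x ∈ xs × y ∈ ys x
  ∈-dependentProduct⁻ {xs = x′ ∷ _} p with ∈-++⁻ (map (x′ ,_) (ys x′)) p
  ... | inj₁ q with _ , y∈ , refl ← ∈-map⁻ (x′ ,_) q = here refl , y∈
  ... | inj₂ q with x∈ , y∈ ← ∈-dependentProduct⁻ q = there x∈ , y∈

  length-dependentProduct : ∀ xs → length (dependentProduct xs ys) ≡ sum (map (length ∘ ys) xs)
  length-dependentProduct []       = refl
  length-dependentProduct (x ∷ xs) = begin
    length (map (x ,_) (ys x) ++ dependentProduct xs ys)            ≡⟨ length-++ (map (x ,_) (ys x)) ⟩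
    length (map (x ,_) (ys x)) + length (dependentProduct xs ys)    ≡⟨ cong₂ _+_ (length-map (x ,_) (ys x))
                                                                                 (length-dependentProduct xs) ⟩
    length (ys x) + sum (map (length ∘ ys) xs)                      ∎
    where open ≡-Reasoning

  dependentProduct-unique : Unique xs → (∀ x → Unique (ys x)) → Unique (dependentProduct xs ys)
  dependentProduct-unique []            _   = []
  dependentProduct-unique {xs = x ∷ xs} (x∉xs ∷ xs-unique) ys-unique =
    Unique.++⁺ (Unique.map⁺ (cong proj₂) (ys-unique x))
               (dependentProduct-unique xs-unique ys-unique)
               disjoint
    where
    disjoint : ∀ {v} → ¬ (v ∈ map (x ,_) (ys x) × v ∈ dependentProduct xs ys)
    disjoint (p , q) with _ , _ , refl ← ∈-map⁻ (x ,_) p = All.lookup x∉xs (proj₁ (∈-dependentProduct⁻ q)) refl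

map-unique-on : {f : A → B} →
  (∀ {x y} → x ∈ xs → y ∈ xs → f x ≡ f y → x ≡ y) → Unique xs → Unique (map f xs)
map-unique-on _   []              = []
map-unique-on inj (x∉xs ∷ unique) =
  All.map⁺ (All.tabulate λ y∈ fx≡fy → All.lookup x∉xs y∈ (inj (here refl) (there y∈) fx≡fy))
  ∷ map-unique-on (λ p q → inj (there p) (there q)) unique

optional : Bool → A → List A
optional t x = if t then x ∷ [] else []

∈-optional⁺ : ∀ {t} → T t → c ∈ optional t c
∈-optional⁺ {t = true} _ = here refl

∈-optional⁻ : ∀ t → c′ ∈ optional t c → T t × c′ ≡ c
∈-optional⁻ true (here eq) = _ , eq

length-optional : ∀ t → length (optional t c) ≡ (if t then 1 else 0)
length-optional true  = refl
length-optional false = refl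

optional-unique : ∀ t → Unique (optional t c)
optional-unique true  = [] ∷ []
optional-unique false = []

⊆-++-split : ∀ xs {ys P : List A} → P ⊆ xs ++ ys →
  ∃[ P₁ ] ∃[ P₂ ] P ≡ P₁ ++ P₂ × P₁ ⊆ xs × P₂ ⊆ ys
⊆-++-split []       p = [] , _ , refl , [] , p
⊆-++-split (x ∷ xs) (.x ∷ʳ p) with P₁ , P₂ , refl , p₁ , p₂ ← ⊆-++-split xs p =
  P₁ , P₂ , refl , x ∷ʳ p₁ , p₂
⊆-++-split (x ∷ xs) (refl ∷ p) with P₁ , P₂ , refl , p₁ , p₂ ← ⊆-++-split xs p =
  x ∷ P₁ , P₂ , refl , refl ∷ p₁ , p₂

⊆-replicate⁺ : m ≤ n → replicate m c ⊆ replicate n c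
⊆-replicate⁺ {n = n} z≤n = []⊆-universal (replicate n _)
⊆-replicate⁺ (s≤s m≤n)   = refl ∷ ⊆-replicate⁺ m≤n

⊆-replicate⁻ : ∀ n {P : List A} → P ⊆ replicate n c → ∃[ m ] m ≤ n × P ≡ replicate m c
⊆-replicate⁻ zero    []        = 0 , z≤n , refl
⊆-replicate⁻ (suc n) (_ ∷ʳ p) with m , m≤n , refl ← ⊆-replicate⁻ n p = m , m≤n⇒m≤1+n m≤n , refl
⊆-replicate⁻ (suc n) (refl ∷ p) with m , m≤n , refl ← ⊆-replicate⁻ n p = suc m , s≤s m≤n , refl

U^_D^_U^_D^_ : ℕ → ℕ → ℕ → ℕ → Word
U^ x D^ y U^ z D^ w = replicate x U ++ replicate y D ++ replicate z U ++ replicate w D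

private
  variable
    x y z w x′ y′ z′ w′ : ℕ

U^D^U^D^-mono-⊆ : x′ ≤ x → y′ ≤ y → z′ ≤ z → w′ ≤ w →
  U^ x′ D^ y′ U^ z′ D^ w′ ⊆ U^ x D^ y U^ z D^ w
U^D^U^D^-mono-⊆ x′≤x y′≤y z′≤z w′≤w =
  ++⁺ (⊆-replicate⁺ x′≤x) (++⁺ (⊆-replicate⁺ y′≤y) (++⁺ (⊆-replicate⁺ z′≤z) (⊆-replicate⁺ w′≤w)))

⊆-U^D^U^D^⁻ : ∀ {P} → P ⊆ U^ x D^ y U^ z D^ w →
  ∃[ x′ ] ∃[ y′ ] ∃[ z′ ] ∃[ w′ ] x′ ≤ x × y′ ≤ y × z′ ≤ z × w′ ≤ w × P ≡ U^ x′ D^ y′ U^ z′ D^ w′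
⊆-U^D^U^D^⁻ {x} {y} {z} {w} p
  with P₁ , R₁ , refl , p₁ , r₁ ← ⊆-++-split (replicate x U) p
  with P₂ , R₂ , refl , p₂ , r₂ ← ⊆-++-split (replicate y D) r₁
  with P₃ , P₄ , refl , p₃ , p₄ ← ⊆-++-split (replicate z U) r₂
  with x′ , x′≤x , refl ← ⊆-replicate⁻ x p₁
  with y′ , y′≤y , refl ← ⊆-replicate⁻ y p₂
  with z′ , z′≤z , refl ← ⊆-replicate⁻ z p₃
  with w′ , w′≤w , refl ← ⊆-replicate⁻ w p₄ =
  x′ , y′ , z′ , w′ , x′≤x , y′≤y , z′≤z , w′≤w , refl

UD-⊆-U^D^U^D^ : ∀ z w → 1 ≤ x → 1 ≤ y → UD ⊆ U^ x D^ y U^ z D^ w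
UD-⊆-U^D^U^D^ {suc x} _ _ (s≤s _) (s≤s _) = refl ∷ ++⁺ˡ (replicate x U) (refl ∷ []⊆-universal _)

U≢D : U ≢ D
U≢D ()

U^D^U^D^-injective : ∀ x x′ → 1 ≤ y → 1 ≤ z → 1 ≤ w → 1 ≤ y′ → 1 ≤ z′ → 1 ≤ w′ →
  U^ x D^ y U^ z D^ w ≡ U^ x′ D^ y′ U^ z′ D^ w′ → x ≡ x′ × y ≡ y′ × z ≡ z′ × w ≡ w′
U^D^U^D^-injective {w = suc w} {w′ = suc w′} _ _ (s≤s _) (s≤s _) (s≤s _) (s≤s _) (s≤s _) (s≤s _) eq
  with refl , eq₁ ← replicate-++-∷-injective U≢D eq
  with refl , eq₂ ← replicate-++-∷-injective (U≢D ∘ sym) eq₁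
  with refl , eq₃ ← replicate-++-∷-injective U≢D eq₂ =
  refl , refl , refl , cong suc (trans (sym (length-replicate w)) (trans (cong length eq₃) (length-replicate w′)))

U^D^U^D^-merge-U : ∀ x z w → U^ x D^ 0 U^ z D^ w ≡ U^ x + z D^ w U^ 0 D^ 0
U^D^U^D^-merge-U x z w = begin
  replicate x U ++ replicate z U ++ replicate w D     ≡⟨ ++-assoc (replicate x U) _ _ ⟨
  (replicate x U ++ replicate z U) ++ replicate w D   ≡⟨ cong (_++ replicate w D) (replicate-+ x z U) ⟨
  replicate (x + z) U ++ replicate w D               ≡⟨ cong (replicate (x + z) U ++_) (++-identityʳ _) ⟨
  replicate (x + z) U ++ replicate w D ++ []         ∎
  where open ≡-Reasoning

U^D^U^D^-merge-D : ∀ x y w → U^ x D^ y U^ 0 D^ w ≡ U^ x D^ y + w U^ 0 D^ 0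
U^D^U^D^-merge-D x y w =
  cong (replicate x U ++_) (trans (sym (replicate-+ y w D)) (sym (++-identityʳ _)))

semilength-U^ : ∀ k l → semilength (replicate k U ++ l) ≡ k + semilength l
semilength-U^ zero    l = refl
semilength-U^ (suc k) l = cong suc (semilength-U^ k l)

semilength-D^ : ∀ k l → semilength (replicate k D ++ l) ≡ semilength l
semilength-D^ zero    l = refl
semilength-D^ (suc k) l = semilength-D^ k l

semilength-U^D^U^D^ : ∀ x y z w → semilength (U^ x D^ y U^ z D^ w) ≡ x + z
semilength-U^D^U^D^ x y z w = begin
  semilength (U^ x D^ y U^ z D^ w)                        ≡⟨ semilength-U^ x _ ⟩
  x + semilength (replicate y D ++ replicate z U ++ Dʷ)   ≡⟨ cong (x +_) (semilength-D^ y _) ⟩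
  x + semilength (replicate z U ++ Dʷ)                    ≡⟨ cong (x +_) (semilength-U^ z _) ⟩
  x + (z + semilength Dʷ)                                 ≡⟨ cong (λ s → x + (z + semilength s)) (++-identityʳ Dʷ) ⟨
  x + (z + semilength (Dʷ ++ []))                         ≡⟨ cong (λ s → x + (z + s)) (semilength-D^ w []) ⟩
  x + (z + 0)                                             ≡⟨ cong (x +_) (+-identityʳ z) ⟩
  x + z                                                   ∎
  where
  open ≡-Reasoning
  Dʷ = replicate w D

DyckFrom-U^⁺ : ∀ k → DyckFrom (k + n) l → DyckFrom n (replicate k U ++ l)
DyckFrom-U^⁺ zero    d = d
DyckFrom-U^⁺ {n} {l} (suc k) d = up (DyckFrom-U^⁺ k (subst (λ m → DyckFrom m l) (sym (+-suc k n)) d))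

DyckFrom-U^⁻ : ∀ k → DyckFrom n (replicate k U ++ l) → DyckFrom (k + n) l
DyckFrom-U^⁻ zero    d      = d
DyckFrom-U^⁻ {n} {l} (suc k) (up d) = subst (λ m → DyckFrom m l) (+-suc k n) (DyckFrom-U^⁻ k d)

DyckFrom-D^⁺ : ∀ k → DyckFrom n l → DyckFrom (k + n) (replicate k D ++ l)
DyckFrom-D^⁺ zero    d = d
DyckFrom-D^⁺ (suc k) d = down (DyckFrom-D^⁺ k d)

DyckFrom-D^⁻ : ∀ k → DyckFrom m (replicate k D ++ l) → ∃[ n ] m ≡ k + n × DyckFrom n l
DyckFrom-D^⁻ zero    d        = _ , refl , d
DyckFrom-D^⁻ (suc k) (down d) with n , refl , d′ ← DyckFrom-D^⁻ k d = n , refl , d′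

DyckFrom-replicate-D⁺ : ∀ k → DyckFrom k (replicate k D)
DyckFrom-replicate-D⁺ zero    = done
DyckFrom-replicate-D⁺ (suc k) = down (DyckFrom-replicate-D⁺ k)

DyckFrom-replicate-D⁻ : ∀ k → DyckFrom m (replicate k D) → m ≡ k
DyckFrom-replicate-D⁻ zero    done     = refl
DyckFrom-replicate-D⁻ (suc k) (down d) = cong suc (DyckFrom-replicate-D⁻ k d)

-- n is the height of the valley between the two peaks.
Dyck-U^D^U^D^ : ∀ x y z w → Dyck (U^ x D^ y U^ z D^ w) ⇔ (∃[ n ] x ≡ y + n × w ≡ z + n)
Dyck-U^D^U^D^ x y z w = mk⇔ valley dyck
  where
  valley : Dyck (U^ x D^ y U^ z D^ w) → ∃[ n ] x ≡ y + n × w ≡ z + n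
  valley d with n , x+0≡y+n , d′ ← DyckFrom-D^⁻ y (DyckFrom-U^⁻ x d) =
    n , trans (sym (+-identityʳ x)) x+0≡y+n , sym (DyckFrom-replicate-D⁻ w (DyckFrom-U^⁻ z d′))

  dyck : ∃[ n ] x ≡ y + n × w ≡ z + n → Dyck (U^ x D^ y U^ z D^ w)
  dyck (n , x≡y+n , w≡z+n) =
    DyckFrom-U^⁺ x (subst (λ m → DyckFrom m (replicate y D ++ replicate z U ++ replicate w D))
                          (trans (sym x≡y+n) (sym (+-identityʳ x)))
      (DyckFrom-D^⁺ y (DyckFrom-U^⁺ z
        (subst (λ m → DyckFrom m (replicate w D)) w≡z+n (DyckFrom-replicate-D⁺ w)))))

U^D^U^D^-one-peak≢two-peaks : ∀ x x′ w′ → 1 ≤ y → 1 ≤ y′ → 1 ≤ z′ →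
  U^ x D^ y U^ 0 D^ 0 ≢ U^ x′ D^ y′ U^ z′ D^ w′
U^D^U^D^-one-peak≢two-peaks {y = suc y} {y′ = suc y′} _ _ _ (s≤s _) (s≤s _) (s≤s _) eq
  with _ , eq′ ← replicate-++-∷-injective U≢D eq =
  0≢1+n (trans (sym (semilength-D^ y [])) (trans (cong semilength eq′) (semilength-D^ y′ _)))

m+n≡o⇒o∸p≤n⇔m≤p : ∀ {m n o} p → m + n ≡ o → (o ∸ p ≤ n ⇔ m ≤ p)
m+n≡o⇒o∸p≤n⇔m≤p {m} {n} {o} p m+n≡o = mk⇔
  (λ o∸p≤n → +-cancelʳ-≤ n m p (subst (_≤ p + n) (sym m+n≡o) (≤-trans (m≤n+m∸n o p) (+-monoʳ-≤ p o∸p≤n))))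
  (λ m≤p → m≤n+o⇒m∸n≤o o p (subst (_≤ p + n) m+n≡o (+-monoˡ-≤ n m≤p)))

module Interval (a b h r : ℕ) where

  InInterval : Word → Set
  InInterval = InIntervalOfSemilength (Qabh a b h) r

  onePeak : Word
  onePeak = U^ r D^ r U^ 0 D^ 0

  onePeak-∈ : 1 ≤ r → r ≤ b + h → InInterval onePeak
  onePeak-∈ 1≤r r≤b+h =
      from (Dyck-U^D^U^D^ r r 0 0) (0 , sym (+-identityʳ r) , refl)
    , UD-⊆-U^D^U^D^ 0 0 1≤r 1≤r
    , subst (_⊆ Qabh a b h) onePeak-split (U^D^U^D^-mono-⊆ r∸b≤a+h (z≤n {a}) (m⊓n≤m b r) r≤b+h)
    , trans (semilength-U^D^U^D^ r r 0 0) (+-identityʳ r)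
    where
    r∸b≤a+h : r ∸ b ≤ a + h
    r∸b≤a+h = ≤-trans (m≤n+o⇒m∸n≤o r b r≤b+h) (m≤n+m h a)

    onePeak-split : U^ r ∸ b D^ 0 U^ b ⊓ r D^ r ≡ onePeak
    onePeak-split = trans (U^D^U^D^-merge-U (r ∸ b) (b ⊓ r) r)
      (cong (λ s → U^ s D^ r U^ 0 D^ 0) (trans (+-comm (r ∸ b) (b ⊓ r)) (m⊓n+n∸m≡n b r)))

  valley : ℕ → ℕ → ℕ
  valley i z = r ∸ (i + z)

  -- The two-peak path with first descent i and second ascent z; its semilength r fixes the valley.
  twoPeak : ℕ → ℕ → Word
  twoPeak i z = U^ i + valley i z D^ i U^ z D^ (z + valley i z)

  record TwoPeakFits (i z : ℕ) : Set where
    field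
      1≤i       : 1 ≤ i
      1≤z       : 1 ≤ z
      i+z≤r     : i + z ≤ r
      i≤a       : i ≤ a
      z≤b       : z ≤ b
      r∸[b+h]≤i : r ∸ (b + h) ≤ i
      r∸[a+h]≤z : r ∸ (a + h) ≤ z

  valley-+ : ∀ {i z} → i + z ≤ r → (i + valley i z) + z ≡ r
  valley-+ {i} {z} i+z≤r = trans (xy∙z≈xz∙y i (valley i z) z) (m+[n∸m]≡n i+z≤r)

  valley-unique : ∀ {i n z} → (i + n) + z ≡ r → valley i z ≡ n
  valley-unique {i} {n} {z} i+n+z≡r = begin
    r ∸ (i + z)             ≡⟨ cong (_∸ (i + z)) (trans (sym i+n+z≡r) (xy∙z≈xz∙y i n z)) ⟩
    (i + z + n) ∸ (i + z)   ≡⟨ m+n∸m≡n (i + z) n ⟩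
    n                       ∎
    where open ≡-Reasoning

  twoPeak-∈ : ∀ {i z} → TwoPeakFits i z → InInterval (twoPeak i z)
  twoPeak-∈ {i} {z} fits =
      from (Dyck-U^D^U^D^ (i + v) i z (z + v)) (v , refl , refl)
    , UD-⊆-U^D^U^D^ z (z + v) (≤-trans 1≤i (m≤m+n i v)) 1≤i
    , U^D^U^D^-mono-⊆ (to (m+n≡o⇒o∸p≤n⇔m≤p (a + h) semilength≡r) r∸[a+h]≤z) i≤a z≤b
        (to (m+n≡o⇒o∸p≤n⇔m≤p (b + h) (trans (xy∙z≈zy∙x z v i) semilength≡r)) r∸[b+h]≤i)
    , trans (semilength-U^D^U^D^ (i + v) i z (z + v)) semilength≡r
    where
    open TwoPeakFits fits
    v = valley i z
    semilength≡r : (i + v) + z ≡ r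
    semilength≡r = valley-+ {i} {z} i+z≤r

  twoPeak-injective : ∀ {i z i′ z′} → TwoPeakFits i z → TwoPeakFits i′ z′ →
    twoPeak i z ≡ twoPeak i′ z′ → (i , z) ≡ (i′ , z′)
  twoPeak-injective {i} {z} {i′} {z′} fits fits′ eq =
    let _ , i≡i′ , z≡z′ , _ = U^D^U^D^-injective (i + valley i z) (i′ + valley i′ z′)
                                1≤i 1≤z (1≤z+v fits) 1≤i′ 1≤z′ (1≤z+v fits′) eq
    in cong₂ _,_ i≡i′ z≡z′
    where
    open TwoPeakFits fits
    open TwoPeakFits fits′ renaming (1≤i to 1≤i′; 1≤z to 1≤z′)
    1≤z+v : ∀ {i z} → TwoPeakFits i z → 1 ≤ z + valley i z
    1≤z+v {i} {z} f = ≤-trans (TwoPeakFits.1≤z f) (m≤m+n z (valley i z))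

  onePeak≢twoPeak : ∀ {i z} → 1 ≤ r → TwoPeakFits i z → onePeak ≢ twoPeak i z
  onePeak≢twoPeak {i} {z} 1≤r fits =
    U^D^U^D^-one-peak≢two-peaks r (i + valley i z) (z + valley i z) 1≤r 1≤i 1≤z
    where open TwoPeakFits fits

  iMin iMax zMin : ℕ
  iMin = 1 ⊔ (r ∸ (b + h))
  iMax = a ⊓ (r ∸ 1)
  zMin = 1 ⊔ (r ∸ (a + h))

  zMax : ℕ → ℕ
  zMax i = b ⊓ (r ∸ i)

  rows : List ℕ
  rows = range iMin (suc iMax)

  columns : ℕ → List ℕ
  columns i = range zMin (suc (zMax i))

  twoPeakIndices : List (ℕ × ℕ)
  twoPeakIndices = dependentProduct rows columns

  twoPeakIndices⁺ : ∀ {i z} → TwoPeakFits i z → (i , z) ∈ twoPeakIndices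
  twoPeakIndices⁺ {i} {z} fits = ∈-dependentProduct⁺
    (∈-range⁺ (⊔-lub 1≤i r∸[b+h]≤i) (s≤s (⊓-glb i≤a (m+n≤o⇒m≤o∸n i (≤-trans (+-monoʳ-≤ i 1≤z) i+z≤r)))))
    (∈-range⁺ (⊔-lub 1≤z r∸[a+h]≤z) (s≤s (⊓-glb z≤b (m+n≤o⇒m≤o∸n z (subst (_≤ r) (+-comm i z) i+z≤r)))))
    where open TwoPeakFits fits

  twoPeakIndices⁻ : ∀ {i z} → (i , z) ∈ twoPeakIndices → TwoPeakFits i z
  twoPeakIndices⁻ {i} {z} i,z∈ =
    let i∈ , z∈            = ∈-dependentProduct⁻ i,z∈
        iMin≤i , i<1+iMax = ∈-range⁻ i∈
        zMin≤z , z<1+zMax = ∈-range⁻ z∈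
        i≤iMax = ≤-pred i<1+iMax
        z≤zMax = ≤-pred z<1+zMax
        i≤r    = ≤-trans (m≤n⊓o⇒m≤o a (r ∸ 1) i≤iMax) (m∸n≤m r 1)
    in record
      { 1≤i       = m⊔n≤o⇒m≤o 1 (r ∸ (b + h)) iMin≤i
      ; 1≤z       = m⊔n≤o⇒m≤o 1 (r ∸ (a + h)) zMin≤z
      ; i+z≤r     = subst (_≤ r) (+-comm z i) (m≤o∸n⇒m+n≤o z i≤r (m≤n⊓o⇒m≤o b (r ∸ i) z≤zMax))
      ; i≤a       = m≤n⊓o⇒m≤n a (r ∸ 1) i≤iMax
      ; z≤b       = m≤n⊓o⇒m≤n b (r ∸ i) z≤zMax
      ; r∸[b+h]≤i = m⊔n≤o⇒n≤o 1 (r ∸ (b + h)) iMin≤i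
      ; r∸[a+h]≤z = m⊔n≤o⇒n≤o 1 (r ∸ (a + h)) zMin≤z
      }

  twoPeakIndices-unique : Unique twoPeakIndices
  twoPeakIndices-unique =
    dependentProduct-unique (range-unique iMin (suc iMax)) (λ i → range-unique zMin (suc (zMax i)))

  OnePeakElement TwoPeakElement : Word → Set
  OnePeakElement P = r ≤ b + h × P ≡ onePeak
  TwoPeakElement P = ∃[ i ] ∃[ z ] TwoPeakFits i z × P ≡ twoPeak i z

  classify-U^D^U^D^ : a ≤ b → ∀ {x w n} y z → x ≡ y + n → w ≡ z + n → x + z ≡ r →
    x ≤ a + h → y ≤ a → z ≤ b → w ≤ b + h →
    OnePeakElement (U^ x D^ y U^ z D^ w) ⊎ TwoPeakElement (U^ x D^ y U^ z D^ w)
  classify-U^D^U^D^ _ {n = n} zero z refl refl n+z≡r _ _ _ w≤b+h =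
    inj₁ (subst (_≤ b + h) w≡r w≤b+h ,
          trans (U^D^U^D^-merge-U n z (z + n)) (cong₂ (λ p q → U^ p D^ q U^ 0 D^ 0) n+z≡r w≡r))
    where
    w≡r = trans (+-comm z n) n+z≡r
  classify-U^D^U^D^ a≤b {n = n} (suc y) zero refl refl x+0≡r x≤a+h _ _ _ =
    inj₁ (subst (_≤ b + h) x≡r (≤-trans x≤a+h (+-monoˡ-≤ h a≤b)) ,
          trans (U^D^U^D^-merge-D (suc y + n) (suc y) n) (cong (λ p → U^ p D^ p U^ 0 D^ 0) x≡r))
    where
    x≡r = trans (sym (+-identityʳ (suc y + n))) x+0≡r
  classify-U^D^U^D^ _ {n = n} (suc y) (suc z) refl refl x+z≡r x≤a+h y≤a z≤b w≤b+h =
    inj₂ (suc y , suc z , fits ,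
          cong (λ v → U^ suc y + v D^ suc y U^ suc z D^ (suc z + v)) (sym (valley-unique {suc y} {n} {suc z} x+z≡r)))
    where
    fits : TwoPeakFits (suc y) (suc z)
    fits = record
      { 1≤i       = s≤s z≤n
      ; 1≤z       = s≤s z≤n
      ; i+z≤r     = subst (suc y + suc z ≤_) x+z≡r (+-monoˡ-≤ (suc z) (m≤m+n (suc y) n))
      ; i≤a       = y≤a
      ; z≤b       = z≤b
      ; r∸[b+h]≤i = from (m+n≡o⇒o∸p≤n⇔m≤p (b + h) (trans (xy∙z≈zy∙x (suc z) n (suc y)) x+z≡r)) w≤b+h
      ; r∸[a+h]≤z = from (m+n≡o⇒o∸p≤n⇔m≤p (a + h) x+z≡r) x≤a+h
      }

  classify : a ≤ b → ∀ {P} → InInterval P → OnePeakElement P ⊎ TwoPeakElement P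
  classify a≤b (dyck , _ , P⊆Q , semilength≡r)
    with x , y , z , w , x≤a+h , y≤a , z≤b , w≤b+h , refl ← ⊆-U^D^U^D^⁻ P⊆Q
    with n , x≡y+n , w≡z+n ← to (Dyck-U^D^U^D^ x y z w) dyck =
    classify-U^D^U^D^ a≤b y z x≡y+n w≡z+n (trans (sym (semilength-U^D^U^D^ x y z w)) semilength≡r)
      x≤a+h y≤a z≤b w≤b+h

  onePeaks twoPeaks elements : List Word
  onePeaks = optional (r ≤ᵇ b + h) onePeak
  twoPeaks = map (uncurry twoPeak) twoPeakIndices
  elements = onePeaks ++ twoPeaks

  ∈-elements⇔ : 1 ≤ r → a ≤ b → ∀ P → P ∈ elements ⇔ InInterval P
  ∈-elements⇔ 1≤r a≤b P = mk⇔ sound complete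
    where
    sound : P ∈ elements → InInterval P
    sound P∈ with ∈-++⁻ onePeaks P∈
    ... | inj₁ P∈onePeaks with r≤b+h , refl ← ∈-optional⁻ (r ≤ᵇ b + h) P∈onePeaks =
      onePeak-∈ 1≤r (≤ᵇ⇒≤ r (b + h) r≤b+h)
    ... | inj₂ P∈twoPeaks with _ , i,z∈ , refl ← ∈-map⁻ (uncurry twoPeak) P∈twoPeaks =
      twoPeak-∈ (twoPeakIndices⁻ i,z∈)

    complete : InInterval P → P ∈ elements
    complete P∈ with classify a≤b P∈
    ... | inj₁ (r≤b+h , refl)        = ∈-++⁺ˡ (∈-optional⁺ (≤⇒≤ᵇ r≤b+h))
    ... | inj₂ (i , z , fits , refl) = ∈-++⁺ʳ onePeaks (∈-map⁺ (uncurry twoPeak) (twoPeakIndices⁺ fits))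

  elements-unique : 1 ≤ r → Unique elements
  elements-unique 1≤r = Unique.++⁺ (optional-unique (r ≤ᵇ b + h))
    (map-unique-on (λ c∈ c′∈ → twoPeak-injective (twoPeakIndices⁻ c∈) (twoPeakIndices⁻ c′∈))
                   twoPeakIndices-unique)
    disjoint
    where
    disjoint : ∀ {P} → ¬ (P ∈ onePeaks × P ∈ twoPeaks)
    disjoint (P∈onePeaks , P∈twoPeaks)
      with _ , refl ← ∈-optional⁻ (r ≤ᵇ b + h) P∈onePeaks
      with _ , i,z∈ , eq ← ∈-map⁻ (uncurry twoPeak) P∈twoPeaks =
      onePeak≢twoPeak 1≤r (twoPeakIndices⁻ i,z∈) eq

  length-elements : length elements ≡ formula a b h r
  length-elements = begin
    length (onePeaks ++ twoPeaks)                            ≡⟨ length-++ onePeaks ⟩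
    length onePeaks + length twoPeaks                        ≡⟨ cong₂ _+_ (length-optional (r ≤ᵇ b + h))
                                                                          (length-map (uncurry twoPeak) twoPeakIndices) ⟩
    iver≤ r (b + h) + length twoPeakIndices                  ≡⟨ cong (iver≤ r (b + h) +_) length-twoPeakIndices ⟩
    iver≤ r (b + h) + sumFromTo iMin iMax summand            ≡⟨ +-comm (iver≤ r (b + h)) _ ⟩
    formula a b h r                                          ∎
    where
    open ≡-Reasoning
    summand : ℕ → ℕ
    summand i = (zMax i + 1) ∸ zMin

    length-twoPeakIndices : length twoPeakIndices ≡ sumFromTo iMin iMax summand
    length-twoPeakIndices = begin
      length twoPeakIndices                     ≡⟨ length-dependentProduct rows ⟩
      sum (map (length ∘ columns) rows)         ≡⟨ cong sum (map-cong length-columns rows) ⟩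
      sum (map summand rows)                    ≡⟨ sumFromTo-range iMin iMax summand ⟨
      sumFromTo iMin iMax summand               ∎
      where
      length-columns : ∀ i → length (columns i) ≡ summand i
      length-columns i = trans (length-range zMin (suc (zMax i))) (cong (_∸ zMin) (+-comm 1 (zMax i)))

mainTheorem7 : (a b h r : ℕ) → 1 ≤ a → a ≤ b → 2 ≤ r → r ≤ a + b + h →
    Σ (List Word) (λ L → Unique L
    × ((P : Word) → (P ∈ L) ⇔ InIntervalOfSemilength (Qabh a b h) r P)
    × length L ≡ formula a b h r)
mainTheorem7 a b h r _ a≤b 2≤r _ = elements , elements-unique 1≤r , ∈-elements⇔ 1≤r a≤b , length-elements
  where
  open Interval a b h r
  1≤r : 1 ≤ r
  1≤r = ≤-trans (s≤s z≤n) 2≤r
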